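{- Let $p>5$ be a prime and $k\in\mathbb{F}_p$. The number of solutions $(x,y,z)\in\mathbb{F}_p^3$ of $x^2+y^2+z^2-xyz-2=k$ is \[p^2+\left(3+\left(\frac{k+2}{p}\right)\right)\left(\frac{k-2}{p}\right)p+1.\]
   Context: $\left(\frac{\cdot}{p}\right)$ is the Legendre symbol, with $\left(\frac{0}{p}\right)=0$. -}

module Defs where

open import Data.Nat using (ℕ; _+_; _*_; _∸_; _≟_; NonZero)
open import Data.Nat.DivMod using (_%_)
open import Data.Fin using (Fin; toℕ)
open import Data.Fin.Properties using (any?)
open import Data.List using (List; length; filter; allFin; cartesianProduct)
open import Data.Product using (_×_; _,_; ∃)
open import Data.Integer using (ℤ; +_; -_)
open import Relation.Binary.PropositionalEquality using (_≡_)
open import Relation.Nullary using (yes; no)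

-- Elements of 𝔽_p are represented by Fin p (residues 0, …, p-1);
-- arithmetic in 𝔽_p is ℕ-arithmetic followed by reduction mod p.

IsSquareMod : (p : ℕ) → .{{NonZero p}} → ℕ → Set
IsSquareMod p a = ∃ λ (t : Fin p) → (toℕ t * toℕ t) % p ≡ a % p

legendre : (p : ℕ) → .{{NonZero p}} → ℕ → ℤ
legendre p a with a % p ≟ 0
... | yes _ = + 0
... | no _ with any? (λ (t : Fin p) → (toℕ t * toℕ t) % p ≟ a % p)
...   | yes _ = + 1
...   | no _  = - (+ 1)

triples : (p : ℕ) → List (Fin p × Fin p × Fin p)
triples p = cartesianProduct (allFin p) (cartesianProduct (allFin p) (allFin p))

-- number of (x,y,z) ∈ 𝔽_p³ with x² + y² + z² - xyz - 2 = k in 𝔽_p,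
-- i.e. x² + y² + z² ≡ k + xyz + 2 (mod p)
solutionCount : (p : ℕ) → .{{NonZero p}} → Fin p → ℕ
solutionCount p k = length (filter
  (λ { (x , y , z) →
       (toℕ x * toℕ x + toℕ y * toℕ y + toℕ z * toℕ z) % p
         ≟ (toℕ k + toℕ x * toℕ y * toℕ z + 2) % p })
  (triples p))

{-# OPTIONS --safe #-}
module Submission where

-- Let χ be the quadratic character of 𝔽ₚ, A = x² − 4 and B = 4 (k + 2 − x²). Completing the square
-- in z, 4 (x² + y² + z² − xyz − 2 − k) = (2z − xy)² − (A y² + B), so (x, y) extends to 1 + χ (A y² + B)
-- solutions. By multiplicativity of χ and ∑_z χ (z² + c) = −1 for c ≠ 0, summing over y gives
-- p − χ A + [A = 0] p χ B + [B = 0] p χ A. Summing over x, ∑ₓ χ (x² − 4) = −1; A = 0 exactly at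
-- x = ±2, where B = 4 (k − 2); and B = 0 at the 1 + χ (k + 2) roots of x² = k + 2, where A = k − 2.

open import Defs using (legendre; triples; solutionCount)
open import Data.Nat as ℕ using (ℕ; zero; suc; NonZero; _<_; _>_; z≤n; s≤s)
import Data.Nat.Properties as ℕP
open import Data.Nat.DivMod using (_%_; _mod_; m%n<n; m<n⇒m%n≡m; n%n≡0; m*n%n≡0; [m+kn]%n≡m%n; %-distribˡ-+; %-distribˡ-*)
open import Data.Nat.Divisibility using (_∣_; m%n≡0⇒n∣m; ∣⇒≤)
open import Data.Nat.Coprimality using (coprime-Bézout; prime⇒coprime)
open import Data.Nat.GCD using (module Bézout)
open import Data.Nat.Primality using (Prime; euclidsLemma; prime⇒nonTrivial)
open import Data.Integer as ℤ using (ℤ; +_; -[1+_]; _⊖_; 0ℤ; 1ℤ; -1ℤ; _≤_; +≤+; -≤+)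
  renaming (_+_ to _+ℤ_; _*_ to _*ℤ_; -_ to -ℤ_; _-_ to _-ℤ_)
import Data.Integer.Properties as ℤP
open import Data.Integer.Tactic.RingSolver using (solve-∀)
import Data.Sign as Sign
open import Data.Fin using (Fin; zero; suc; toℕ; _≟_)
open import Data.Fin.Properties using (toℕ-injective; toℕ<n; toℕ-fromℕ<; suc-injective; any?)
open import Data.Fin.Permutation using (permutation)
open import Data.List as List using (List; []; _∷_; _++_; map; length; filter; allFin; cartesianProduct; foldr)
import Data.List.Properties as ListP
open import Data.Maybe using (just; nothing)
open import Data.Product using (_×_; _,_; ∃; proj₁; proj₂)
open import Data.Sum as Sum using (_⊎_; inj₁; inj₂)
open import Function using (_∘_; id; _⇔_; mk⇔; Equivalence)
open import Relation.Binary.PropositionalEquality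
open import Relation.Binary.Definitions using (WeaklyDecidable)
open import Relation.Nullary using (¬_; Dec; yes; no; contradiction)
open import Relation.Unary using (Pred; Decidable)
open import Algebra.Bundles using (CommutativeRing)
open import Algebra.Structures using (IsCommutativeRing)
open import Algebra.Solver.Ring.AlmostCommutativeRing as ACR using (_-Raw-AlmostCommutative⟶_)
open import Algebra.Properties.AbelianGroup ℤP.+-0-abelianGroup using (∙-cancelˡ; inverseˡ-unique)
open import Algebra.Properties.Semiring.Sum ℤP.+-*-semiring
  using (sum; sum-syntax; sum-cong-≗; sum-replicate-zero; sum-permute; ∑-comm; ∑-distrib-+; *-distribˡ-sum; *-distribʳ-sum)
open ≡-Reasoning

𝟙 : ∀ {P : Set} → Dec P → ℤ
𝟙 (yes _) = 1ℤ
𝟙 (no _)  = 0ℤ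

𝟙-yes : ∀ {P : Set} (P? : Dec P) → P → 𝟙 P? ≡ 1ℤ
𝟙-yes (yes _) _  = refl
𝟙-yes (no ¬p) p = contradiction p ¬p

𝟙-no : ∀ {P : Set} (P? : Dec P) → ¬ P → 𝟙 P? ≡ 0ℤ
𝟙-no (yes p) ¬p = contradiction p ¬p
𝟙-no (no _)  _  = refl

𝟙-cong : ∀ {P Q : Set} (P? : Dec P) (Q? : Dec Q) → P ⇔ Q → 𝟙 P? ≡ 𝟙 Q?
𝟙-cong P? (yes q) P⇔Q = 𝟙-yes P? (Equivalence.from P⇔Q q)
𝟙-cong P? (no ¬q) P⇔Q = 𝟙-no P? (¬q ∘ Equivalence.to P⇔Q)

𝟙-*-cong : ∀ {P : Set} (P? : Dec P) {i j : ℤ} → (P → i ≡ j) → 𝟙 P? *ℤ i ≡ 𝟙 P? *ℤ j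
𝟙-*-cong (yes p) P→i≡j = cong (1ℤ *ℤ_) (P→i≡j p)
𝟙-*-cong (no _)  _     = refl

δ : ∀ {n} → Fin n → Fin n → ℤ
δ a b = 𝟙 (a ≟ b)

δ-≢ : ∀ {n} {a b : Fin n} → a ≢ b → δ a b ≡ 0ℤ
δ-≢ {a = a} {b} = 𝟙-no (a ≟ b)

δ-sym : ∀ {n} (a b : Fin n) → δ a b ≡ δ b a
δ-sym a b = 𝟙-cong (a ≟ b) (b ≟ a) (mk⇔ sym sym)

∑-cong : ∀ {n} {f g : Fin n → ℤ} → (∀ i → f i ≡ g i) → sum f ≡ sum g
∑-cong = sum-cong-≗

∑-const : ∀ n (c : ℤ) → ∑[ i < n ] c ≡ + n *ℤ c
∑-const zero    c = sym (ℤP.*-zeroˡ c)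
∑-const (suc n) c = begin
  c +ℤ ∑[ i < n ] c  ≡⟨ cong (c +ℤ_) (∑-const n c) ⟩
  c +ℤ + n *ℤ c      ≡⟨ cong (_+ℤ + n *ℤ c) (sym (ℤP.*-identityˡ c)) ⟩
  1ℤ *ℤ c +ℤ + n *ℤ c ≡⟨ sym (ℤP.*-distribʳ-+ c 1ℤ (+ n)) ⟩
  + suc n *ℤ c       ∎

∑-reindex : ∀ {n} (σ τ : Fin n → Fin n) → (∀ i → σ (τ i) ≡ i) → (∀ i → τ (σ i) ≡ i) →
  (f : Fin n → ℤ) → ∑[ i < n ] f (σ i) ≡ ∑[ i < n ] f i
∑-reindex σ τ στ τσ f = sym (sum-permute f (permutation σ τ στ τσ))

∑-*ˡ : ∀ {n} (c : ℤ) (f : Fin n → ℤ) → ∑[ i < n ] (c *ℤ f i) ≡ c *ℤ ∑[ i < n ] f i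
∑-*ˡ c f = sym (*-distribˡ-sum c f)

∑-neg : ∀ {n} (f : Fin n → ℤ) → ∑[ i < n ] (-ℤ f i) ≡ -ℤ ∑[ i < n ] f i
∑-neg {n} f = begin
  ∑[ i < n ] (-ℤ f i)       ≡⟨ ∑-cong (λ i → ℤP.-1*i≡-i (f i)) ⟨
  ∑[ i < n ] (-1ℤ *ℤ f i)    ≡⟨ ∑-*ˡ -1ℤ f ⟩
  -1ℤ *ℤ ∑[ i < n ] f i      ≡⟨ ℤP.-1*i≡-i (sum f) ⟩
  -ℤ ∑[ i < n ] f i         ∎

∑-*ʳ : ∀ {n} (c : ℤ) (f : Fin n → ℤ) → ∑[ i < n ] (f i *ℤ c) ≡ ∑[ i < n ] f i *ℤ c
∑-*ʳ c f = sym (*-distribʳ-sum c f)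

∑-δˡ : ∀ {n} (a : Fin n) → ∑[ i < n ] δ i a ≡ 1ℤ
∑-δˡ {suc n} zero = cong (1ℤ +ℤ_) rest
  where
  rest : ∑[ i < n ] δ (suc i) zero ≡ 0ℤ
  rest = trans (∑-cong {n} (λ i → δ-≢ {a = suc i} {zero} λ ())) (sum-replicate-zero n)
∑-δˡ {suc n} (suc a) = begin
  δ zero (suc a) +ℤ ∑[ i < n ] δ (suc i) (suc a) ≡⟨ cong₂ _+ℤ_ (δ-≢ {a = zero} {suc a} λ ()) (∑-cong δ-suc) ⟩
  0ℤ +ℤ ∑[ i < n ] δ i a                         ≡⟨ ℤP.+-identityˡ _ ⟩
  ∑[ i < n ] δ i a                               ≡⟨ ∑-δˡ a ⟩
  1ℤ                                             ∎
  where
  δ-suc : ∀ i → δ (suc i) (suc a) ≡ δ i a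
  δ-suc i = 𝟙-cong (suc i ≟ suc a) (i ≟ a) (mk⇔ suc-injective (cong suc))

∑-δʳ : ∀ {n} (a : Fin n) → ∑[ i < n ] δ a i ≡ 1ℤ
∑-δʳ a = trans (∑-cong (δ-sym a)) (∑-δˡ a)

≤-+-≡⇒≡ : ∀ {a b c d : ℤ} → a ≤ b → c ≤ d → a +ℤ c ≡ b +ℤ d → a ≡ b
≤-+-≡⇒≡ {a} {b} a≤b c≤d eq with a ℤ.≟ b
... | yes a≡b = a≡b
... | no  a≢b = contradiction eq (ℤP.<⇒≢ (ℤP.+-mono-<-≤ (ℤP.≤∧≢⇒< a≤b a≢b) c≤d))

∑-≤-≡⇒≗ : ∀ {n} {f g : Fin n → ℤ} → (∀ i → f i ≤ g i) → sum f ≡ sum g → ∀ i → f i ≡ g i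
∑-≤-≡⇒≗ {suc n} {f} {g} f≤g eq zero = ≤-+-≡⇒≡ (f≤g zero) (∑-mono-≤ (f≤g ∘ suc)) eq
  where
  ∑-mono-≤ : ∀ {m} {f g : Fin m → ℤ} → (∀ i → f i ≤ g i) → sum f ≤ sum g
  ∑-mono-≤ {zero}  _   = ℤP.≤-refl
  ∑-mono-≤ {suc m} f≤g = ℤP.+-mono-≤ (f≤g zero) (∑-mono-≤ (f≤g ∘ suc))
∑-≤-≡⇒≗ {suc n} {f} {g} f≤g eq (suc i) = ∑-≤-≡⇒≗ (f≤g ∘ suc) tail-eq i
  where
  tail-eq : sum (f ∘ suc) ≡ sum (g ∘ suc)
  tail-eq = ∙-cancelˡ (f zero) _ _
    (trans eq (cong (_+ℤ sum (g ∘ suc)) (sym (∑-≤-≡⇒≗ f≤g eq zero))))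

sumˡ : List ℤ → ℤ
sumˡ = foldr _+ℤ_ 0ℤ

+length-filter≡sumˡ-𝟙 : ∀ {A : Set} {P : Pred A _} (P? : Decidable P) (xs : List A) →
  + length (filter P? xs) ≡ sumˡ (map (𝟙 ∘ P?) xs)
+length-filter≡sumˡ-𝟙 P? []       = refl
+length-filter≡sumˡ-𝟙 P? (x ∷ xs) with P? x
... | yes _ = cong (1ℤ +ℤ_) (+length-filter≡sumˡ-𝟙 P? xs)
... | no  _ = trans (+length-filter≡sumˡ-𝟙 P? xs) (sym (ℤP.+-identityˡ _))

sumˡ-++ : ∀ (xs ys : List ℤ) → sumˡ (xs ++ ys) ≡ sumˡ xs +ℤ sumˡ ys
sumˡ-++ []       ys = sym (ℤP.+-identityˡ _)
sumˡ-++ (x ∷ xs) ys = trans (cong (x +ℤ_) (sumˡ-++ xs ys)) (sym (ℤP.+-assoc x _ _))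

sumˡ-cartesianProduct : ∀ {A B : Set} (h : A × B → ℤ) (xs : List A) (ys : List B) →
  sumˡ (map h (cartesianProduct xs ys)) ≡ sumˡ (map (λ x → sumˡ (map (λ y → h (x , y)) ys)) xs)
sumˡ-cartesianProduct h []       ys = refl
sumˡ-cartesianProduct h (x ∷ xs) ys = begin
  sumˡ (map h (map (x ,_) ys ++ cartesianProduct xs ys))
    ≡⟨ cong sumˡ (ListP.map-++ h (map (x ,_) ys) _) ⟩
  sumˡ (map h (map (x ,_) ys) ++ map h (cartesianProduct xs ys))
    ≡⟨ sumˡ-++ (map h (map (x ,_) ys)) _ ⟩
  sumˡ (map h (map (x ,_) ys)) +ℤ sumˡ (map h (cartesianProduct xs ys))
    ≡⟨ cong₂ _+ℤ_ (cong sumˡ (sym (ListP.map-∘ ys))) (sumˡ-cartesianProduct h xs ys) ⟩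
  sumˡ (map (λ y → h (x , y)) ys) +ℤ sumˡ (map (λ x → sumˡ (map (λ y → h (x , y)) ys)) xs)
    ∎

sumˡ-allFin : ∀ n (f : Fin n → ℤ) → sumˡ (map f (allFin n)) ≡ ∑[ i < n ] f i
sumˡ-allFin n f = trans (cong sumˡ (ListP.map-tabulate {n = n} id f)) (sumˡ-tabulate n f)
  where
  sumˡ-tabulate : ∀ n (f : Fin n → ℤ) → sumˡ (List.tabulate f) ≡ ∑[ i < n ] f i
  sumˡ-tabulate zero    f = refl
  sumˡ-tabulate (suc n) f = cong (f zero +ℤ_) (sumˡ-tabulate n (f ∘ suc))

sumˡ-allFin-× : ∀ m n (h : Fin m × Fin n → ℤ) →
  sumˡ (map h (cartesianProduct (allFin m) (allFin n))) ≡ ∑[ x < m ] ∑[ y < n ] h (x , y)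
sumˡ-allFin-× m n h = begin
  sumˡ (map h (cartesianProduct (allFin m) (allFin n)))                ≡⟨ sumˡ-cartesianProduct h (allFin m) (allFin n) ⟩
  sumˡ (map (λ x → sumˡ (map (λ y → h (x , y)) (allFin n))) (allFin m)) ≡⟨ sumˡ-allFin m _ ⟩
  ∑[ x < m ] sumˡ (map (λ y → h (x , y)) (allFin n))                   ≡⟨ ∑-cong (λ x → sumˡ-allFin n (λ y → h (x , y))) ⟩
  ∑[ x < m ] ∑[ y < n ] h (x , y)                                      ∎

+length-filter-triples≡∑∑∑-𝟙 : ∀ n {P : Pred (Fin n × Fin n × Fin n) _} (P? : Decidable P) →
  + length (filter P? (triples n)) ≡ ∑[ x < n ] ∑[ y < n ] ∑[ z < n ] 𝟙 (P? (x , y , z))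
+length-filter-triples≡∑∑∑-𝟙 n P? = begin
  + length (filter P? (triples n))                   ≡⟨ +length-filter≡sumˡ-𝟙 P? (triples n) ⟩
  sumˡ (map (𝟙 ∘ P?) (triples n))                    ≡⟨ sumˡ-cartesianProduct (𝟙 ∘ P?) (allFin n) _ ⟩
  sumˡ (map (λ x → sumˡ (map (λ yz → 𝟙 (P? (x , yz))) (cartesianProduct (allFin n) (allFin n)))) (allFin n))
                                                     ≡⟨ sumˡ-allFin n _ ⟩
  ∑[ x < n ] sumˡ (map (λ yz → 𝟙 (P? (x , yz))) (cartesianProduct (allFin n) (allFin n)))
                                                     ≡⟨ ∑-cong (λ x → sumˡ-allFin-× n n (λ yz → 𝟙 (P? (x , yz)))) ⟩
  ∑[ x < n ] ∑[ y < n ] ∑[ z < n ] 𝟙 (P? (x , y , z)) ∎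

module IntegersModulo (n : ℕ) .{{_ : NonZero n}} where

  embed : ℕ → Fin n
  embed m = m mod n

  toℕ-embed : ∀ m → toℕ (embed m) ≡ m % n
  toℕ-embed m = toℕ-fromℕ< (m%n<n m n)

  embed-toℕ : ∀ (a : Fin n) → embed (toℕ a) ≡ a
  embed-toℕ a = toℕ-injective (trans (toℕ-embed (toℕ a)) (m<n⇒m%n≡m (toℕ<n a)))

  embed-≡ : ∀ {l m} → l % n ≡ m % n → embed l ≡ embed m
  embed-≡ {l} {m} e = toℕ-injective (trans (toℕ-embed l) (trans e (sym (toℕ-embed m))))

  0%n≡0 : 0 % n ≡ 0
  0%n≡0 = m<n⇒m%n≡m (ℕ.>-nonZero⁻¹ n)

  embed-elim : ∀ {P : Fin n → Set} → (∀ l → P (embed l)) → ∀ a → P a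
  embed-elim {P} h a = subst P (embed-toℕ a) (h (toℕ a))

  embed-elim₂ : ∀ {P : Fin n → Fin n → Set} → (∀ l m → P (embed l) (embed m)) → ∀ a b → P a b
  embed-elim₂ {P} h a = embed-elim (λ m → embed-elim {P = λ a → P a (embed m)} (λ l → h l m) a)

  embed-elim₃ : ∀ {P : Fin n → Fin n → Fin n → Set} →
    (∀ l m o → P (embed l) (embed m) (embed o)) → ∀ a b c → P a b c
  embed-elim₃ {P} h a b = embed-elim (λ o → embed-elim₂ {P = λ a b → P a b (embed o)} (λ l m → h l m o) a b)

  infixl 6 _+_ _-_
  infixl 7 _*_
  infix  8 -_

  0# 1# : Fin n
  0# = embed 0
  1# = embed 1

  toℕ-0# : toℕ 0# ≡ 0
  toℕ-0# = trans (toℕ-embed 0) 0%n≡0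

  embed-multiple : ∀ m → embed (m ℕ.* n) ≡ 0#
  embed-multiple m = embed-≡ (trans (m*n%n≡0 m n) (sym 0%n≡0))

  embed-n : embed n ≡ 0#
  embed-n = embed-≡ (trans (n%n≡0 n) (sym 0%n≡0))

  opaque
    _+_ : Fin n → Fin n → Fin n
    a + b = embed (toℕ a ℕ.+ toℕ b)

    _*_ : Fin n → Fin n → Fin n
    a * b = embed (toℕ a ℕ.* toℕ b)

    -_ : Fin n → Fin n
    - a = embed (n ℕ.∸ toℕ a)

    toℕ-* : ∀ a b → toℕ (a * b) ≡ (toℕ a ℕ.* toℕ b) % n
    toℕ-* a b = toℕ-embed _

    -‿embed : ∀ a → - a ≡ embed (n ℕ.∸ toℕ a)
    -‿embed a = refl

    embed-+ : ∀ l m → embed (l ℕ.+ m) ≡ embed l + embed m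
    embed-+ l m = embed-≡ (trans (%-distribˡ-+ l m n)
      (sym (cong₂ (λ u v → (u ℕ.+ v) % n) (toℕ-embed l) (toℕ-embed m))))

    embed-* : ∀ l m → embed (l ℕ.* m) ≡ embed l * embed m
    embed-* l m = embed-≡ (trans (%-distribˡ-* l m n)
      (sym (cong₂ (λ u v → (u ℕ.* v) % n) (toℕ-embed l) (toℕ-embed m))))

  _-_ : Fin n → Fin n → Fin n
  a - b = a + - b

  +-assoc : ∀ a b c → (a + b) + c ≡ a + (b + c)
  +-assoc = embed-elim₃ λ l m o → begin
    embed l + embed m + embed o   ≡⟨ cong (_+ embed o) (embed-+ l m) ⟨
    embed (l ℕ.+ m) + embed o     ≡⟨ embed-+ (l ℕ.+ m) o ⟨
    embed (l ℕ.+ m ℕ.+ o)         ≡⟨ cong embed (ℕP.+-assoc l m o) ⟩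
    embed (l ℕ.+ (m ℕ.+ o))       ≡⟨ embed-+ l (m ℕ.+ o) ⟩
    embed l + embed (m ℕ.+ o)     ≡⟨ cong₂ _+_ refl (embed-+ m o) ⟩
    embed l + (embed m + embed o) ∎

  *-assoc : ∀ a b c → (a * b) * c ≡ a * (b * c)
  *-assoc = embed-elim₃ λ l m o → begin
    embed l * embed m * embed o   ≡⟨ cong (_* embed o) (embed-* l m) ⟨
    embed (l ℕ.* m) * embed o     ≡⟨ embed-* (l ℕ.* m) o ⟨
    embed (l ℕ.* m ℕ.* o)         ≡⟨ cong embed (ℕP.*-assoc l m o) ⟩
    embed (l ℕ.* (m ℕ.* o))       ≡⟨ embed-* l (m ℕ.* o) ⟩
    embed l * embed (m ℕ.* o)     ≡⟨ cong (embed l *_) (embed-* m o) ⟩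
    embed l * (embed m * embed o) ∎

  *-distribˡ-+ : ∀ a b c → a * (b + c) ≡ a * b + a * c
  *-distribˡ-+ = embed-elim₃ λ l m o → begin
    embed l * (embed m + embed o)     ≡⟨ cong (embed l *_) (embed-+ m o) ⟨
    embed l * embed (m ℕ.+ o)         ≡⟨ embed-* l (m ℕ.+ o) ⟨
    embed (l ℕ.* (m ℕ.+ o))           ≡⟨ cong embed (ℕP.*-distribˡ-+ l m o) ⟩
    embed (l ℕ.* m ℕ.+ l ℕ.* o)       ≡⟨ embed-+ (l ℕ.* m) (l ℕ.* o) ⟩
    embed (l ℕ.* m) + embed (l ℕ.* o) ≡⟨ cong₂ _+_ (embed-* l m) (embed-* l o) ⟩
    embed l * embed m + embed l * embed o ∎

  +-comm : ∀ a b → a + b ≡ b + a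
  +-comm = embed-elim₂ λ l m →
    trans (sym (embed-+ l m)) (trans (cong embed (ℕP.+-comm l m)) (embed-+ m l))

  *-comm : ∀ a b → a * b ≡ b * a
  *-comm = embed-elim₂ λ l m →
    trans (sym (embed-* l m)) (trans (cong embed (ℕP.*-comm l m)) (embed-* m l))

  +-identityˡ : ∀ a → 0# + a ≡ a
  +-identityˡ = embed-elim λ l → sym (embed-+ 0 l)

  *-identityˡ : ∀ a → 1# * a ≡ a
  *-identityˡ = embed-elim λ l → trans (sym (embed-* 1 l)) (cong embed (ℕP.*-identityˡ l))

  -‿inverseʳ : ∀ a → a + - a ≡ 0#
  -‿inverseʳ a = begin
    a + - a                                ≡⟨ cong₂ _+_ (embed-toℕ a) (sym (-‿embed a)) ⟨
    embed (toℕ a) + embed (n ℕ.∸ toℕ a)    ≡⟨ embed-+ (toℕ a) (n ℕ.∸ toℕ a) ⟨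
    embed (toℕ a ℕ.+ (n ℕ.∸ toℕ a))        ≡⟨ cong embed (ℕP.m+[n∸m]≡n (ℕP.<⇒≤ (toℕ<n a))) ⟩
    embed n                                ≡⟨ embed-n ⟩
    0#                                     ∎

  +-*-isCommutativeRing : IsCommutativeRing _≡_ _+_ _*_ -_ 0# 1#
  +-*-isCommutativeRing = record
    { isRing = record
      { +-isAbelianGroup = record
        { isGroup = record
          { isMonoid = record
            { isSemigroup = record
              { isMagma = record { isEquivalence = isEquivalence ; ∙-cong = cong₂ _+_ }
              ; assoc = +-assoc }
            ; identity = +-identityˡ , λ a → trans (+-comm a 0#) (+-identityˡ a) }
          ; inverse = (λ a → trans (+-comm (- a) a) (-‿inverseʳ a)) , -‿inverseʳ
          ; ⁻¹-cong = cong (λ a → - a) }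
        ; comm = +-comm }
      ; *-cong = cong₂ _*_
      ; *-assoc = *-assoc
      ; *-identity = *-identityˡ , λ a → trans (*-comm a 1#) (*-identityˡ a)
      ; distrib = *-distribˡ-+ , λ a b c → begin
          (b + c) * a   ≡⟨ *-comm (b + c) a ⟩
          a * (b + c)   ≡⟨ *-distribˡ-+ a b c ⟩
          a * b + a * c ≡⟨ cong₂ _+_ (*-comm a b) (*-comm a c) ⟩
          b * a + c * a ∎ }
    ; *-comm = *-comm }

  +-*-commutativeRing : CommutativeRing _ _
  +-*-commutativeRing = record { isCommutativeRing = +-*-isCommutativeRing }

  open import Algebra.Properties.Ring (CommutativeRing.ring +-*-commutativeRing)
    using (-0#≈0#; -‿involutive; -‿+-comm; -‿distribˡ-*; -‿distribʳ-*; //-rightDividesʳ; ⁻¹-anti-homo-//)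

  embed-toℕ-* : ∀ a b → embed (toℕ a ℕ.* toℕ b) ≡ a * b
  embed-toℕ-* a b = trans (embed-* (toℕ a) (toℕ b)) (cong₂ _*_ (embed-toℕ a) (embed-toℕ b))

  𝟙-%-≟≡δ : ∀ l m → 𝟙 (l % n ℕ.≟ m % n) ≡ δ (embed l) (embed m)
  𝟙-%-≟≡δ l m = 𝟙-cong (l % n ℕ.≟ m % n) (embed l ≟ embed m) (mk⇔ embed-≡ λ e →
    trans (sym (toℕ-embed l)) (trans (cong toℕ e) (toℕ-embed m)))

  fromℤ : ℤ → Fin n
  fromℤ (+ m)     = embed m
  fromℤ -[1+ m ] = - embed (suc m)

  fromℤ-neg : ∀ i → fromℤ (-ℤ i) ≡ - fromℤ i
  fromℤ-neg (+ zero)  = sym -0#≈0#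
  fromℤ-neg (+ suc m) = refl
  fromℤ-neg -[1+ m ]  = sym (-‿involutive _)

  fromℤ-⊖-≥ : ∀ {l m} → m ℕ.≤ l → fromℤ (l ⊖ m) ≡ embed l - embed m
  fromℤ-⊖-≥ {l} {m} m≤l = begin
    fromℤ (l ⊖ m)                         ≡⟨ cong fromℤ (ℤP.⊖-≥ m≤l) ⟩
    embed (l ℕ.∸ m)                       ≡⟨ //-rightDividesʳ (embed m) (embed (l ℕ.∸ m)) ⟨
    embed (l ℕ.∸ m) + embed m - embed m   ≡⟨ cong (_- embed m) (embed-+ (l ℕ.∸ m) m) ⟨
    embed (l ℕ.∸ m ℕ.+ m) - embed m       ≡⟨ cong (λ t → embed t - embed m) (ℕP.m∸n+n≡m m≤l) ⟩
    embed l - embed m                     ∎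

  fromℤ-⊖ : ∀ l m → fromℤ (l ⊖ m) ≡ embed l - embed m
  fromℤ-⊖ l m with ℕP.≤-total m l
  ... | inj₁ m≤l = fromℤ-⊖-≥ m≤l
  ... | inj₂ l≤m = begin
    fromℤ (l ⊖ m)             ≡⟨ cong fromℤ (ℤP.⊖-swap l m) ⟩
    fromℤ (-ℤ (m ⊖ l))       ≡⟨ fromℤ-neg (m ⊖ l) ⟩
    - fromℤ (m ⊖ l)           ≡⟨ cong (λ a → - a) (fromℤ-⊖-≥ l≤m) ⟩
    - (embed m - embed l)     ≡⟨ ⁻¹-anti-homo-// (embed m) (embed l) ⟩
    embed l - embed m         ∎

  fromℤ-+ : ∀ i j → fromℤ (i ℤ.+ j) ≡ fromℤ i + fromℤ j
  fromℤ-+ (+ l)     (+ m)     = embed-+ l m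
  fromℤ-+ (+ l)     -[1+ m ]  = fromℤ-⊖ l (suc m)
  fromℤ-+ -[1+ l ]  (+ m)     = trans (fromℤ-⊖ m (suc l)) (+-comm (embed m) _)
  fromℤ-+ -[1+ l ]  -[1+ m ]  = begin
    - embed (suc (suc (l ℕ.+ m)))          ≡⟨ cong (λ t → - embed (suc t)) (ℕP.+-suc l m) ⟨
    - embed (suc l ℕ.+ suc m)              ≡⟨ cong (λ a → - a) (embed-+ (suc l) (suc m)) ⟩
    - (embed (suc l) + embed (suc m))      ≡⟨ -‿+-comm (embed (suc l)) (embed (suc m)) ⟨
    - embed (suc l) + - embed (suc m)      ∎

  fromℤ-* : ∀ i j → fromℤ (i ℤ.* j) ≡ fromℤ i * fromℤ j
  fromℤ-* (+ l) (+ m) = trans (cong fromℤ (ℤP.+◃n≡+n (l ℕ.* m))) (embed-* l m)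
  fromℤ-* (+ l) -[1+ m ] = begin
    fromℤ (Sign.- ℤ.◃ (l ℕ.* suc m))   ≡⟨ cong fromℤ (ℤP.-◃n≡-n (l ℕ.* suc m)) ⟩
    fromℤ (-ℤ (+ (l ℕ.* suc m)))      ≡⟨ fromℤ-neg (+ (l ℕ.* suc m)) ⟩
    - embed (l ℕ.* suc m)              ≡⟨ cong (λ a → - a) (embed-* l (suc m)) ⟩
    - (embed l * embed (suc m))        ≡⟨ -‿distribʳ-* (embed l) (embed (suc m)) ⟩
    embed l * - embed (suc m)          ∎
  fromℤ-* -[1+ l ] (+ m) = begin
    fromℤ (Sign.- ℤ.◃ (suc l ℕ.* m))   ≡⟨ cong fromℤ (ℤP.-◃n≡-n (suc l ℕ.* m)) ⟩
    fromℤ (-ℤ (+ (suc l ℕ.* m)))      ≡⟨ fromℤ-neg (+ (suc l ℕ.* m)) ⟩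
    - embed (suc l ℕ.* m)              ≡⟨ cong (λ a → - a) (embed-* (suc l) m) ⟩
    - (embed (suc l) * embed m)        ≡⟨ -‿distribˡ-* (embed (suc l)) (embed m) ⟩
    - embed (suc l) * embed m          ∎
  fromℤ-* -[1+ l ] -[1+ m ] = begin
    fromℤ (Sign.+ ℤ.◃ (suc l ℕ.* suc m))   ≡⟨ cong fromℤ (ℤP.+◃n≡+n (suc l ℕ.* suc m)) ⟩
    embed (suc l ℕ.* suc m)                ≡⟨ embed-* (suc l) (suc m) ⟩
    a * b                                  ≡⟨ -‿involutive (a * b) ⟨
    - - (a * b)                            ≡⟨ cong (λ c → - c) (-‿distribʳ-* a b) ⟩
    - (a * - b)                            ≡⟨ -‿distribˡ-* a (- b) ⟩
    - a * - b                              ∎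
    where
    a = embed (suc l)
    b = embed (suc m)

  fromℤ-homomorphism : ℤ.+-*-rawRing -Raw-AlmostCommutative⟶ ACR.fromCommutativeRing +-*-commutativeRing
  fromℤ-homomorphism = record
    { ⟦_⟧ = fromℤ ; +-homo = fromℤ-+ ; *-homo = fromℤ-* ; -‿homo = fromℤ-neg ; 0-homo = refl ; 1-homo = refl }

  fromℤ-≟ : WeaklyDecidable (λ i j → fromℤ i ≡ fromℤ j)
  fromℤ-≟ i j with i ℤ.≟ j
  ... | yes i≡j = just (cong fromℤ i≡j)
  ... | no  _   = nothing

  open import Algebra.Solver.Ring ℤ.+-*-rawRing (ACR.fromCommutativeRing +-*-commutativeRing) fromℤ-homomorphism fromℤ-≟ public
    using (solve; _:=_; _:+_; _:*_; :-_; _:-_; con)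

module PrimeField (p : ℕ) .{{_ : NonZero p}} (p-prime : Prime p) where

  open IntegersModulo p public
  open CommutativeRing +-*-commutativeRing public using (zeroˡ; zeroʳ; +-identityʳ)
  open import Algebra.Properties.Ring (CommutativeRing.ring +-*-commutativeRing) public
    using (-0#≈0#; -‿involutive; -‿distribʳ-*; x∙y⁻¹≈ε⇒x≈y; x≈y⇒x∙y⁻¹≈ε; +-inverseʳ-unique)

  toℕ≡0⇒≡0# : ∀ {a} → toℕ a ≡ 0 → a ≡ 0#
  toℕ≡0⇒≡0# {a} e = toℕ-injective (trans e (sym toℕ-0#))

  embed≢0# : ∀ {m} → 0 < m → m < p → embed m ≢ 0#
  embed≢0# {m} 0<m m<p e = ℕP.<⇒≢ 0<m (sym (begin
    m              ≡⟨ m<n⇒m%n≡m m<p ⟨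
    m % p          ≡⟨ toℕ-embed m ⟨
    toℕ (embed m)  ≡⟨ cong toℕ e ⟩
    toℕ 0#         ≡⟨ toℕ-0# ⟩
    0              ∎))

  1#≢0 : 1# ≢ 0#
  1#≢0 = embed≢0# (s≤s z≤n) (ℕ.nonTrivial⇒n>1 p {{prime⇒nonTrivial p-prime}})

  p∣toℕ⇒≡0# : ∀ a → p ∣ toℕ a → a ≡ 0#
  p∣toℕ⇒≡0# a p∣a = toℕ≡0⇒≡0# (below-p (toℕ a) p∣a (toℕ<n a))
    where
    below-p : ∀ m → p ∣ m → m < p → m ≡ 0
    below-p zero    _   _   = refl
    below-p (suc m) p∣m m<p = contradiction (∣⇒≤ p∣m) (ℕP.<⇒≱ m<p)

  x*y≡0⇒x≡0∨y≡0 : ∀ {a b} → a * b ≡ 0# → a ≡ 0# ⊎ b ≡ 0#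
  x*y≡0⇒x≡0∨y≡0 {a} {b} ab≡0 =
    Sum.map (p∣toℕ⇒≡0# a) (p∣toℕ⇒≡0# b) (euclidsLemma (toℕ a) (toℕ b) p-prime p∣ab)
    where
    p∣ab : p ∣ toℕ a ℕ.* toℕ b
    p∣ab = m%n≡0⇒n∣m _ p (trans (sym (toℕ-* a b)) (trans (cong toℕ ab≡0) toℕ-0#))

  x≢0∧y≢0⇒x*y≢0 : ∀ {a b} → a ≢ 0# → b ≢ 0# → a * b ≢ 0#
  x≢0∧y≢0⇒x*y≢0 a≢0 b≢0 ab≡0 = Sum.[ a≢0 , b≢0 ] (x*y≡0⇒x≡0∨y≡0 ab≡0)

  -‿≢0 : ∀ {a} → a ≢ 0# → - a ≢ 0#
  -‿≢0 {a} a≢0 -a≡0 = a≢0 (begin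
    a        ≡⟨ -‿involutive a ⟨
    - - a    ≡⟨ cong (λ b → - b) -a≡0 ⟩
    - 0#     ≡⟨ -0#≈0# ⟩
    0#       ∎)

  *-inverse : ∀ {a} → a ≢ 0# → ∃ λ b → a * b ≡ 1#
  *-inverse {a} a≢0 = from-Bézout (coprime-Bézout (prime⇒coprime p-prime {{nonZero}} (toℕ<n a)))
    where
    nonZero : NonZero (toℕ a)
    nonZero = ℕ.≢-nonZero (λ e → a≢0 (toℕ≡0⇒≡0# e))
    a*embed : ∀ m → a * embed m ≡ embed (m ℕ.* toℕ a)
    a*embed m = begin
      a * embed m              ≡⟨ cong (_* embed m) (embed-toℕ a) ⟨
      embed (toℕ a) * embed m  ≡⟨ embed-* (toℕ a) m ⟨
      embed (toℕ a ℕ.* m)      ≡⟨ cong embed (ℕP.*-comm (toℕ a) m) ⟩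
      embed (m ℕ.* toℕ a)      ∎
    from-Bézout : Bézout.Identity 1 p (toℕ a) → ∃ λ b → a * b ≡ 1#
    from-Bézout (Bézout.-+ x y eq) = embed y , (begin
      a * embed y              ≡⟨ a*embed y ⟩
      embed (y ℕ.* toℕ a)      ≡⟨ cong embed eq ⟨
      embed (1 ℕ.+ x ℕ.* p)    ≡⟨ embed-≡ ([m+kn]%n≡m%n 1 x p) ⟩
      1#                       ∎)
    from-Bézout (Bézout.+- x y eq) = - embed y , (begin
      a * - embed y            ≡⟨ -‿distribʳ-* a (embed y) ⟨
      - (a * embed y)          ≡⟨ cong (λ c → - c) (+-inverseʳ-unique 1# (a * embed y) 1+ay≡0) ⟩
      - - 1#                   ≡⟨ -‿involutive 1# ⟩
      1#                       ∎)
      where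
      1+ay≡0 : 1# + a * embed y ≡ 0#
      1+ay≡0 = begin
        1# + a * embed y             ≡⟨ cong₂ _+_ refl (a*embed y) ⟩
        embed 1 + embed (y ℕ.* toℕ a) ≡⟨ embed-+ 1 (y ℕ.* toℕ a) ⟨
        embed (1 ℕ.+ y ℕ.* toℕ a)     ≡⟨ cong embed eq ⟩
        embed (x ℕ.* p)              ≡⟨ embed-multiple x ⟩
        0#                           ∎

  *-cancelˡ : ∀ {u a b} → u ≢ 0# → u * a ≡ u * b → a ≡ b
  *-cancelˡ {u} {a} {b} u≢0 ua≡ub =
    x∙y⁻¹≈ε⇒x≈y a b (Sum.[ (λ u≡0 → contradiction u≡0 u≢0) , id ] (x*y≡0⇒x≡0∨y≡0 u[a-b]≡0))
    where
    u[a-b]≡0 : u * (a - b) ≡ 0#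
    u[a-b]≡0 = begin
      u * (a - b)        ≡⟨ solve 3 (λ u a b → u :* (a :- b) := u :* a :- u :* b) refl u a b ⟩
      u * a - u * b      ≡⟨ x≈y⇒x∙y⁻¹≈ε ua≡ub ⟩
      0#                 ∎

  x*x≡y*y⇒x≡y∨x≡-y : ∀ {a b} → a * a ≡ b * b → a ≡ b ⊎ a ≡ - b
  x*x≡y*y⇒x≡y∨x≡-y {a} {b} aa≡bb = Sum.map (x∙y⁻¹≈ε⇒x≈y a b) a+b≡0⇒a≡-b (x*y≡0⇒x≡0∨y≡0 [a-b][a+b]≡0)
    where
    a+b≡0⇒a≡-b : a + b ≡ 0# → a ≡ - b
    a+b≡0⇒a≡-b a+b≡0 = x∙y⁻¹≈ε⇒x≈y a (- b) (trans (cong₂ _+_ refl (-‿involutive b)) a+b≡0)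
    [a-b][a+b]≡0 : (a - b) * (a + b) ≡ 0#
    [a-b][a+b]≡0 = begin
      (a - b) * (a + b)  ≡⟨ solve 2 (λ a b → (a :- b) :* (a :+ b) := a :* a :- b :* b) refl a b ⟩
      a * a - b * b      ≡⟨ x≈y⇒x∙y⁻¹≈ε aa≡bb ⟩
      0#                 ∎

  ∑-affine : ∀ {a} b → a ≢ 0# → (f : Fin p → ℤ) → ∑[ w < p ] f (a * w + b) ≡ ∑[ w < p ] f w
  ∑-affine {a} b a≢0 = ∑-reindex (λ w → a * w + b) (λ w → a⁻¹ * (w - b)) forth back
    where
    a⁻¹ = proj₁ (*-inverse a≢0)
    aa⁻¹≡1 : a * a⁻¹ ≡ 1#
    aa⁻¹≡1 = proj₂ (*-inverse a≢0)
    forth : ∀ w → a * (a⁻¹ * (w - b)) + b ≡ w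
    forth w = begin
      a * (a⁻¹ * (w - b)) + b  ≡⟨ solve 4 (λ a a⁻¹ w b →
                                    a :* (a⁻¹ :* (w :- b)) :+ b := (a :* a⁻¹) :* (w :- b) :+ b) refl a a⁻¹ w b ⟩
      (a * a⁻¹) * (w - b) + b  ≡⟨ cong (λ c → c * (w - b) + b) aa⁻¹≡1 ⟩
      1# * (w - b) + b         ≡⟨ solve 2 (λ w b → con (+ 1) :* (w :- b) :+ b := w) refl w b ⟩
      w                        ∎
    back : ∀ w → a⁻¹ * (a * w + b - b) ≡ w
    back w = begin
      a⁻¹ * (a * w + b - b)    ≡⟨ solve 4 (λ a a⁻¹ w b → a⁻¹ :* (a :* w :+ b :- b) := (a :* a⁻¹) :* w) refl a a⁻¹ w b ⟩
      (a * a⁻¹) * w            ≡⟨ cong (_* w) aa⁻¹≡1 ⟩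
      1# * w                   ≡⟨ *-identityˡ w ⟩
      w                        ∎

  ∑-scale : ∀ {a} → a ≢ 0# → (f : Fin p → ℤ) → ∑[ w < p ] f (a * w) ≡ ∑[ w < p ] f w
  ∑-scale {a} a≢0 f = trans (∑-cong (λ w → cong f (sym (+-identityʳ (a * w))))) (∑-affine 0# a≢0 f)

  δ-cong-difference : ∀ {u X Y Z W} → u ≢ 0# → X - Y ≡ u * (Z - W) → δ X Y ≡ δ Z W
  δ-cong-difference {u} {X} {Y} {Z} {W} u≢0 eq = 𝟙-cong (X ≟ Y) (Z ≟ W) (mk⇔ to from)
    where
    to : X ≡ Y → Z ≡ W
    to X≡Y = x∙y⁻¹≈ε⇒x≈y Z W (*-cancelˡ u≢0 (begin
      u * (Z - W)  ≡⟨ eq ⟨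
      X - Y        ≡⟨ x≈y⇒x∙y⁻¹≈ε X≡Y ⟩
      0#           ≡⟨ zeroʳ u ⟨
      u * 0#       ∎))
    from : Z ≡ W → X ≡ Y
    from Z≡W = x∙y⁻¹≈ε⇒x≈y X Y (begin
      X - Y        ≡⟨ eq ⟩
      u * (Z - W)  ≡⟨ cong (u *_) (x≈y⇒x∙y⁻¹≈ε Z≡W) ⟩
      u * 0#       ≡⟨ zeroʳ u ⟩
      0#           ∎)

  ∑-translate : ∀ b (f : Fin p → ℤ) → ∑[ w < p ] f (w + b) ≡ ∑[ w < p ] f w
  ∑-translate b f = trans (∑-cong (λ w → cong (λ c → f (c + b)) (sym (*-identityˡ w)))) (∑-affine b 1#≢0 f)

module QuadraticCharacter (p : ℕ) .{{_ : NonZero p}} (p-prime : Prime p) (2<p : 2 < p) where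

  open PrimeField p p-prime public

  2# 4# : Fin p
  2# = embed 2
  4# = embed 4

  2#≢0 : 2# ≢ 0#
  2#≢0 = embed≢0# (s≤s z≤n) 2<p

  2#*2#≡4# : 2# * 2# ≡ 4#
  2#*2#≡4# = sym (embed-* 2 2)

  4#≢0 : 4# ≢ 0#
  4#≢0 = subst (_≢ 0#) 2#*2#≡4# (x≢0∧y≢0⇒x*y≢0 2#≢0 2#≢0)

  x≢0⇒x≢-x : ∀ {a} → a ≢ 0# → a ≢ - a
  x≢0⇒x≢-x {a} a≢0 a≡-a = a≢0 (*-cancelˡ 2#≢0 (begin
    2# * a    ≡⟨ solve 1 (λ a → con (+ 2) :* a := a :- (:- a)) refl a ⟩
    a - - a   ≡⟨ cong (λ b → a - b) a≡-a ⟨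
    a - a     ≡⟨ x≈y⇒x∙y⁻¹≈ε refl ⟩
    0#        ≡⟨ zeroʳ 2# ⟨
    2# * 0#   ∎))

  IsSquare : Fin p → Set
  IsSquare x = ∃ λ t → t * t ≡ x

  square-isSquare : ∀ t → IsSquare (t * t)
  square-isSquare t = t , refl

  0#-isSquare : IsSquare 0#
  0#-isSquare = 0# , zeroʳ 0#

  4#-isSquare : IsSquare 4#
  4#-isSquare = 2# , 2#*2#≡4#

  root≢0 : ∀ {a t} → a ≢ 0# → t * t ≡ a → t ≢ 0#
  root≢0 a≢0 tt≡a t≡0 = a≢0 (trans (sym tt≡a) (trans (cong (λ u → u * u) t≡0) (zeroʳ 0#)))

  data Residuosity (x : Fin p) : Set where
    zero       : x ≡ 0# → Residuosity x
    residue    : x ≢ 0# → IsSquare x → Residuosity x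
    nonresidue : ¬ IsSquare x → Residuosity x

  opaque
    χ : Fin p → ℤ
    χ x with x ≟ 0#
    ... | yes _ = 0ℤ
    ... | no  _ with any? (λ t → t * t ≟ x)
    ...   | yes _ = 1ℤ
    ...   | no  _ = -1ℤ

    residuosity : ∀ x → Residuosity x
    residuosity x with x ≟ 0#
    ... | yes x≡0 = zero x≡0
    ... | no  x≢0 with any? (λ t → t * t ≟ x)
    ...   | yes □x = residue x≢0 □x
    ...   | no ¬□x = nonresidue ¬□x

    χ-zero : ∀ {x} → x ≡ 0# → χ x ≡ 0ℤ
    χ-zero {x} x≡0 with x ≟ 0#
    ... | yes _   = refl
    ... | no  x≢0 = contradiction x≡0 x≢0

    χ-residue : ∀ {x} → x ≢ 0# → IsSquare x → χ x ≡ 1ℤ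
    χ-residue {x} x≢0 □x with x ≟ 0#
    ... | yes x≡0 = contradiction x≡0 x≢0
    ... | no  _ with any? (λ t → t * t ≟ x)
    ...   | yes _   = refl
    ...   | no ¬□x = contradiction □x ¬□x

    χ-nonresidue : ∀ {x} → ¬ IsSquare x → χ x ≡ -1ℤ
    χ-nonresidue {x} ¬□x with x ≟ 0#
    ... | yes x≡0 = contradiction (subst IsSquare (sym x≡0) 0#-isSquare) ¬□x
    ... | no  _ with any? (λ t → t * t ≟ x)
    ...   | yes □x = contradiction □x ¬□x
    ...   | no  _  = refl

  χ≤1 : ∀ x → χ x ≤ 1ℤ
  χ≤1 x with residuosity x
  ... | zero x≡0      = subst (_≤ 1ℤ) (sym (χ-zero x≡0)) (+≤+ z≤n)
  ... | residue x≢0 □x = subst (_≤ 1ℤ) (sym (χ-residue x≢0 □x)) ℤP.≤-refl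
  ... | nonresidue ¬□x = subst (_≤ 1ℤ) (sym (χ-nonresidue ¬□x)) -≤+

  ∑-δ-square : ∀ D → ∑[ w < p ] δ (w * w) D ≡ 1ℤ +ℤ χ D
  ∑-δ-square D with residuosity D
  ... | zero D≡0 = begin
    ∑[ w < p ] δ (w * w) D  ≡⟨ ∑-cong (λ w → 𝟙-cong (w * w ≟ D) (w ≟ 0#) (mk⇔ (root-of-0 w) (square-of-0 w))) ⟩
    ∑[ w < p ] δ w 0#       ≡⟨ ∑-δˡ 0# ⟩
    1ℤ                      ≡⟨ cong (1ℤ +ℤ_) (χ-zero D≡0) ⟨
    1ℤ +ℤ χ D               ∎
    where
    root-of-0 : ∀ w → w * w ≡ D → w ≡ 0#
    root-of-0 w ww≡D = Sum.[ id , id ] (x*y≡0⇒x≡0∨y≡0 (trans ww≡D D≡0))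
    square-of-0 : ∀ w → w ≡ 0# → w * w ≡ D
    square-of-0 w w≡0 = trans (cong (λ u → u * u) w≡0) (trans (zeroʳ 0#) (sym D≡0))
  ... | residue D≢0 (t , tt≡D) = begin
    ∑[ w < p ] δ (w * w) D                  ≡⟨ ∑-cong two-roots ⟩
    ∑[ w < p ] (δ w t +ℤ δ w (- t))         ≡⟨ ∑-distrib-+ (λ w → δ w t) (λ w → δ w (- t)) ⟩
    ∑[ w < p ] δ w t +ℤ ∑[ w < p ] δ w (- t) ≡⟨ cong₂ _+ℤ_ (∑-δˡ t) (∑-δˡ (- t)) ⟩
    1ℤ +ℤ 1ℤ                                ≡⟨ cong (1ℤ +ℤ_) (χ-residue D≢0 (t , tt≡D)) ⟨
    1ℤ +ℤ χ D                               ∎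
    where
    two-roots : ∀ w → δ (w * w) D ≡ δ w t +ℤ δ w (- t)
    two-roots w with w ≟ t | w ≟ - t
    ... | yes w≡t | yes w≡-t = contradiction (trans (sym w≡t) w≡-t) (x≢0⇒x≢-x (root≢0 D≢0 tt≡D))
    ... | yes refl | no _    = 𝟙-yes (w * w ≟ D) tt≡D
    ... | no _ | yes refl    = 𝟙-yes (w * w ≟ D) (trans (solve 1 (λ t → (:- t) :* (:- t) := t :* t) refl t) tt≡D)
    ... | no w≢t | no w≢-t   = 𝟙-no (w * w ≟ D) λ ww≡D →
      Sum.[ w≢t , w≢-t ] (x*x≡y*y⇒x≡y∨x≡-y (trans ww≡D (sym tt≡D)))
  ... | nonresidue ¬□D = begin
    ∑[ w < p ] δ (w * w) D  ≡⟨ ∑-cong (λ w → 𝟙-no (w * w ≟ D) (λ ww≡D → ¬□D (w , ww≡D))) ⟩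
    ∑[ w < p ] 0ℤ           ≡⟨ sum-replicate-zero p ⟩
    0ℤ                      ≡⟨ cong (1ℤ +ℤ_) (χ-nonresidue ¬□D) ⟨
    1ℤ +ℤ χ D               ∎

  ∑1≡p : ∑[ x < p ] 1ℤ ≡ + p
  ∑1≡p = trans (∑-const p 1ℤ) (ℤP.*-identityʳ (+ p))

  -- Each w is the square root of exactly one D, so summing ∑-δ-square over D gives p = p + ∑ χ.
  ∑χ≡0 : ∑[ x < p ] χ x ≡ 0ℤ
  ∑χ≡0 = ∙-cancelˡ (+ p) (∑[ x < p ] χ x) 0ℤ (begin
    + p +ℤ ∑[ x < p ] χ x                  ≡⟨ cong (_+ℤ ∑[ x < p ] χ x) ∑1≡p ⟨
    ∑[ x < p ] 1ℤ +ℤ ∑[ x < p ] χ x        ≡⟨ ∑-distrib-+ (λ _ → 1ℤ) χ ⟨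
    ∑[ x < p ] (1ℤ +ℤ χ x)                 ≡⟨ ∑-cong ∑-δ-square ⟨
    ∑[ x < p ] ∑[ w < p ] δ (w * w) x      ≡⟨ ∑-comm (λ x w → δ (w * w) x) ⟩
    ∑[ w < p ] ∑[ x < p ] δ (w * w) x      ≡⟨ ∑-cong (λ w → ∑-δʳ (w * w)) ⟩
    ∑[ w < p ] 1ℤ                          ≡⟨ ∑1≡p ⟩
    + p                                    ≡⟨ ℤP.+-identityʳ (+ p) ⟨
    + p +ℤ 0ℤ                              ∎)

  isSquare-* : ∀ {a b} → IsSquare a → IsSquare b → IsSquare (a * b)
  isSquare-* {a} {b} (s , ss≡a) (t , tt≡b) = s * t , (begin
    s * t * (s * t)    ≡⟨ solve 2 (λ s t → s :* t :* (s :* t) := s :* s :* (t :* t)) refl s t ⟩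
    s * s * (t * t)    ≡⟨ cong₂ _*_ ss≡a tt≡b ⟩
    a * b              ∎)

  isSquare-cancelˡ : ∀ {a b} → a ≢ 0# → IsSquare a → IsSquare (a * b) → IsSquare b
  isSquare-cancelˡ {a} {b} a≢0 (s , ss≡a) (u , uu≡ab) = s⁻¹ * u , (begin
    s⁻¹ * u * (s⁻¹ * u)          ≡⟨ solve 2 (λ s⁻¹ u → s⁻¹ :* u :* (s⁻¹ :* u) := s⁻¹ :* s⁻¹ :* (u :* u)) refl s⁻¹ u ⟩
    s⁻¹ * s⁻¹ * (u * u)          ≡⟨ cong (s⁻¹ * s⁻¹ *_) (trans uu≡ab (cong (_* b) (sym ss≡a))) ⟩
    s⁻¹ * s⁻¹ * (s * s * b)      ≡⟨ solve 3 (λ s s⁻¹ b →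
                                        s⁻¹ :* s⁻¹ :* (s :* s :* b) := (s :* s⁻¹) :* (s :* s⁻¹) :* b) refl s s⁻¹ b ⟩
    (s * s⁻¹) * (s * s⁻¹) * b    ≡⟨ cong (λ c → c * c * b) ss⁻¹≡1 ⟩
    1# * 1# * b                  ≡⟨ solve 1 (λ b → con (+ 1) :* con (+ 1) :* b := b) refl b ⟩
    b                            ∎)
    where
    s⁻¹ = proj₁ (*-inverse (root≢0 a≢0 ss≡a))
    ss⁻¹≡1 : s * s⁻¹ ≡ 1#
    ss⁻¹≡1 = proj₂ (*-inverse (root≢0 a≢0 ss≡a))

  χ-*-residue : ∀ {a} → a ≢ 0# → IsSquare a → ∀ b → χ (a * b) ≡ χ b
  χ-*-residue {a} a≢0 □a b with residuosity b
  ... | zero b≡0 = trans (χ-zero (trans (cong (a *_) b≡0) (zeroʳ a))) (sym (χ-zero b≡0))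
  ... | residue b≢0 □b =
    trans (χ-residue (x≢0∧y≢0⇒x*y≢0 a≢0 b≢0) (isSquare-* □a □b)) (sym (χ-residue b≢0 □b))
  ... | nonresidue ¬□b =
    trans (χ-nonresidue (λ □ab → ¬□b (isSquare-cancelˡ a≢0 □a □ab))) (sym (χ-nonresidue ¬□b))

  χ[a*b]+χ[b]≤0 : ∀ {a} → ¬ IsSquare a → ∀ b → χ (a * b) +ℤ χ b ≤ 0ℤ
  χ[a*b]+χ[b]≤0 {a} ¬□a b with residuosity b
  ... | zero b≡0 = ℤP.≤-reflexive (cong₂ _+ℤ_ (χ-zero (trans (cong (a *_) b≡0) (zeroʳ a))) (χ-zero b≡0))
  ... | residue b≢0 □b = ℤP.≤-reflexive (cong₂ _+ℤ_ (χ-nonresidue ¬□ab) (χ-residue b≢0 □b))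
    where
    ¬□ab : ¬ IsSquare (a * b)
    ¬□ab □ab = ¬□a (isSquare-cancelˡ b≢0 □b (subst IsSquare (*-comm a b) □ab))
  ... | nonresidue ¬□b = subst (λ c → χ (a * b) +ℤ c ≤ 0ℤ) (sym (χ-nonresidue ¬□b))
    (ℤP.+-monoˡ-≤ -1ℤ (χ≤1 (a * b)))

  -- b ↦ χ (a b) + χ b is ≤ 0 everywhere, and its sum is 0 because b ↦ a b permutes 𝔽ₚ.
  χ-*-nonresidue : ∀ {a} → ¬ IsSquare a → ∀ b → χ (a * b) ≡ -ℤ χ b
  χ-*-nonresidue {a} ¬□a b = inverseˡ-unique (χ (a * b)) (χ b)
    (∑-≤-≡⇒≗ (χ[a*b]+χ[b]≤0 ¬□a) ∑≡0 b)
    where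
    a≢0 : a ≢ 0#
    a≢0 a≡0 = ¬□a (subst IsSquare (sym a≡0) 0#-isSquare)
    ∑≡0 : ∑[ b < p ] (χ (a * b) +ℤ χ b) ≡ ∑[ b < p ] 0ℤ
    ∑≡0 = begin
      ∑[ b < p ] (χ (a * b) +ℤ χ b)           ≡⟨ ∑-distrib-+ (λ b → χ (a * b)) χ ⟩
      ∑[ b < p ] χ (a * b) +ℤ ∑[ b < p ] χ b  ≡⟨ cong₂ _+ℤ_ (trans (∑-scale a≢0 χ) ∑χ≡0) ∑χ≡0 ⟩
      0ℤ                                      ≡⟨ sum-replicate-zero p ⟨
      ∑[ b < p ] 0ℤ                           ∎

  χ-* : ∀ a b → χ (a * b) ≡ χ a *ℤ χ b
  χ-* a b with residuosity a
  ... | zero a≡0 = begin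
    χ (a * b)        ≡⟨ χ-zero (trans (cong (_* b) a≡0) (zeroˡ b)) ⟩
    0ℤ               ≡⟨ cong (_*ℤ χ b) (χ-zero a≡0) ⟨
    χ a *ℤ χ b       ∎
  ... | residue a≢0 □a = begin
    χ (a * b)        ≡⟨ χ-*-residue a≢0 □a b ⟩
    χ b              ≡⟨ ℤP.*-identityˡ (χ b) ⟨
    1ℤ *ℤ χ b        ≡⟨ cong (_*ℤ χ b) (χ-residue a≢0 □a) ⟨
    χ a *ℤ χ b       ∎
  ... | nonresidue ¬□a = begin
    χ (a * b)        ≡⟨ χ-*-nonresidue ¬□a b ⟩
    -ℤ χ b           ≡⟨ ℤP.-1*i≡-i (χ b) ⟨
    -1ℤ *ℤ χ b       ≡⟨ cong (_*ℤ χ b) (χ-nonresidue ¬□a) ⟨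
    χ a *ℤ χ b       ∎

  ∑-δ-product : ∀ {B} → B ≢ 0# → ∀ w → ∑[ v < p ] δ (w * v) B ≡ 1ℤ -ℤ δ w 0#
  ∑-δ-product {B} B≢0 w with w ≟ 0#
  ... | yes w≡0 = begin
    ∑[ v < p ] δ (w * v) B  ≡⟨ ∑-cong (λ v → δ-≢ {a = w * v} (λ wv≡B → B≢0 (trans (sym wv≡B) (wv≡0 v)))) ⟩
    ∑[ v < p ] 0ℤ           ≡⟨ sum-replicate-zero p ⟩
    0ℤ                      ∎
    where
    wv≡0 : ∀ v → w * v ≡ 0#
    wv≡0 v = trans (cong (_* v) w≡0) (zeroˡ v)
  ... | no w≢0 = begin
    ∑[ v < p ] δ (w * v) B  ≡⟨ ∑-scale w≢0 (λ v → δ v B) ⟩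
    ∑[ v < p ] δ v B        ≡⟨ ∑-δˡ B ⟩
    1ℤ                      ∎

  ∑[1-δ]≡p-1 : ∑[ w < p ] (1ℤ -ℤ δ w 0#) ≡ + p -ℤ 1ℤ
  ∑[1-δ]≡p-1 = begin
    ∑[ w < p ] (1ℤ -ℤ δ w 0#)                ≡⟨ ∑-distrib-+ (λ _ → 1ℤ) (λ w → -ℤ δ w 0#) ⟩
    ∑[ w < p ] 1ℤ +ℤ ∑[ w < p ] (-ℤ δ w 0#)  ≡⟨ cong₂ _+ℤ_ ∑1≡p (∑-neg (λ w → δ w 0#)) ⟩
    + p +ℤ -ℤ ∑[ w < p ] δ w 0#              ≡⟨ cong (λ c → + p -ℤ c) (∑-δˡ 0#) ⟩
    + p -ℤ 1ℤ                                ∎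

  -- w² = z² + B becomes w (2z + w) = B after w ↦ w + z, and then z ↦ 2z + w
  -- leaves one solution v of w v = B for every w ≠ 0.
  ∑χ[z²+B]≡-1 : ∀ {B} → B ≢ 0# → ∑[ z < p ] χ (z * z + B) ≡ -1ℤ
  ∑χ[z²+B]≡-1 {B} B≢0 = ∙-cancelˡ (+ p) _ _ (begin
    + p +ℤ ∑[ z < p ] χ (z * z + B)                     ≡⟨ cong (_+ℤ ∑[ z < p ] χ (z * z + B)) ∑1≡p ⟨
    ∑[ z < p ] 1ℤ +ℤ ∑[ z < p ] χ (z * z + B)           ≡⟨ ∑-distrib-+ (λ _ → 1ℤ) (λ z → χ (z * z + B)) ⟨
    ∑[ z < p ] (1ℤ +ℤ χ (z * z + B))                    ≡⟨ ∑-cong (λ z → ∑-δ-square (z * z + B)) ⟨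
    ∑[ z < p ] ∑[ w < p ] δ (w * w) (z * z + B)         ≡⟨ ∑-cong (λ z → ∑-translate z _) ⟨
    ∑[ z < p ] ∑[ w < p ] δ ((w + z) * (w + z)) (z * z + B)
      ≡⟨ ∑-cong (λ z → ∑-cong λ w → δ-cong-difference 1#≢0 (solve 3 (λ w z B →
           (w :+ z) :* (w :+ z) :- (z :* z :+ B) := con (+ 1) :* (w :* (con (+ 2) :* z :+ w) :- B)) refl w z B)) ⟩
    ∑[ z < p ] ∑[ w < p ] δ (w * (2# * z + w)) B        ≡⟨ ∑-comm (λ z w → δ (w * (2# * z + w)) B) ⟩
    ∑[ w < p ] ∑[ z < p ] δ (w * (2# * z + w)) B        ≡⟨ ∑-cong (λ w → ∑-affine w 2#≢0 (λ v → δ (w * v) B)) ⟩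
    ∑[ w < p ] ∑[ v < p ] δ (w * v) B                   ≡⟨ ∑-cong (∑-δ-product B≢0) ⟩
    ∑[ w < p ] (1ℤ -ℤ δ w 0#)                           ≡⟨ ∑[1-δ]≡p-1 ⟩
    + p -ℤ 1ℤ                                           ∎)

  χ[a*a]≡1 : ∀ {a} → a ≢ 0# → χ (a * a) ≡ 1ℤ
  χ[a*a]≡1 {a} a≢0 = χ-residue (x≢0∧y≢0⇒x*y≢0 a≢0 a≢0) (square-isSquare a)

  χ[y*y]≡1-δ : ∀ y → χ (y * y) ≡ 1ℤ -ℤ δ y 0#
  χ[y*y]≡1-δ y with y ≟ 0#
  ... | yes y≡0 = χ-zero (trans (cong (λ c → c * c) y≡0) (zeroʳ 0#))
  ... | no  y≢0 = χ[a*a]≡1 y≢0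

  ∑χ[0y²+B]≡pχB : ∀ B → ∑[ y < p ] χ (0# * (y * y) + B) ≡ + p *ℤ χ B
  ∑χ[0y²+B]≡pχB B = trans (∑-cong λ y → cong χ (trans (cong (_+ B) (zeroˡ (y * y))) (+-identityˡ B)))
                           (∑-const p (χ B))

  ∑χ[Ay²]≡χA[p-1] : ∀ {A} → A ≢ 0# → ∑[ y < p ] χ (A * (y * y)) ≡ χ A *ℤ (+ p -ℤ 1ℤ)
  ∑χ[Ay²]≡χA[p-1] {A} A≢0 = begin
    ∑[ y < p ] χ (A * (y * y))          ≡⟨ ∑-cong (λ y → χ-* A (y * y)) ⟩
    ∑[ y < p ] (χ A *ℤ χ (y * y))       ≡⟨ ∑-*ˡ (χ A) (λ y → χ (y * y)) ⟩
    χ A *ℤ ∑[ y < p ] χ (y * y)         ≡⟨ cong (χ A *ℤ_) (trans (∑-cong χ[y*y]≡1-δ) ∑[1-δ]≡p-1) ⟩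
    χ A *ℤ (+ p -ℤ 1ℤ)                  ∎

  -- Multiplying by χ A = ±1 and substituting u = A y turns the sum into ∑χ[z²+B]≡-1 at A B.
  ∑χ[Ay²+B]≡-χA : ∀ {A B} → A ≢ 0# → B ≢ 0# → ∑[ y < p ] χ (A * (y * y) + B) ≡ -ℤ χ A
  ∑χ[Ay²+B]≡-χA {A} {B} A≢0 B≢0 = begin
    S                        ≡⟨ ℤP.*-identityˡ S ⟨
    1ℤ *ℤ S                  ≡⟨ cong (_*ℤ S) (trans (sym (χ-* A A)) (χ[a*a]≡1 A≢0)) ⟨
    χ A *ℤ χ A *ℤ S          ≡⟨ ℤP.*-assoc (χ A) (χ A) S ⟩
    χ A *ℤ (χ A *ℤ S)        ≡⟨ cong (χ A *ℤ_) χA*S≡-1 ⟩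
    χ A *ℤ -1ℤ               ≡⟨ trans (ℤP.*-comm (χ A) -1ℤ) (ℤP.-1*i≡-i (χ A)) ⟩
    -ℤ χ A                   ∎
    where
    S = ∑[ y < p ] χ (A * (y * y) + B)
    χA*S≡-1 : χ A *ℤ S ≡ -1ℤ
    χA*S≡-1 = begin
      χ A *ℤ S                                 ≡⟨ ∑-*ˡ (χ A) (λ y → χ (A * (y * y) + B)) ⟨
      ∑[ y < p ] (χ A *ℤ χ (A * (y * y) + B))  ≡⟨ ∑-cong (λ y → χ-* A (A * (y * y) + B)) ⟨
      ∑[ y < p ] χ (A * (A * (y * y) + B))     ≡⟨ ∑-cong (λ y → cong χ (solve 3 (λ A B y →
                                                    A :* (A :* (y :* y) :+ B) := A :* y :* (A :* y) :+ A :* B) refl A B y)) ⟩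
      ∑[ y < p ] χ (A * y * (A * y) + A * B)   ≡⟨ ∑-scale A≢0 (λ u → χ (u * u + A * B)) ⟩
      ∑[ u < p ] χ (u * u + A * B)             ≡⟨ ∑χ[z²+B]≡-1 (x≢0∧y≢0⇒x*y≢0 A≢0 B≢0) ⟩
      -1ℤ                                      ∎

  ∑χ[Ay²+B] : ∀ A B → ∑[ y < p ] χ (A * (y * y) + B)
                     ≡ -ℤ χ A +ℤ δ A 0# *ℤ (+ p *ℤ χ B) +ℤ δ B 0# *ℤ (+ p *ℤ χ A)
  ∑χ[Ay²+B] A B with A ≟ 0# | B ≟ 0#
  ... | yes refl | B≟0 = begin
    ∑[ y < p ] χ (0# * (y * y) + B)
      ≡⟨ ∑χ[0y²+B]≡pχB B ⟩
    + p *ℤ χ B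
      ≡⟨ ℤ-identity (+ p) (χ B) (𝟙 B≟0) ⟩
    -ℤ 0ℤ +ℤ 1ℤ *ℤ (+ p *ℤ χ B) +ℤ 𝟙 B≟0 *ℤ (+ p *ℤ 0ℤ)
      ≡⟨ cong (λ c → -ℤ c +ℤ 1ℤ *ℤ (+ p *ℤ χ B) +ℤ 𝟙 B≟0 *ℤ (+ p *ℤ c)) (χ-zero refl) ⟨
    -ℤ χ 0# +ℤ 1ℤ *ℤ (+ p *ℤ χ B) +ℤ 𝟙 B≟0 *ℤ (+ p *ℤ χ 0#)
      ∎
    where
    ℤ-identity : ∀ q b d → q *ℤ b ≡ -ℤ 0ℤ +ℤ 1ℤ *ℤ (q *ℤ b) +ℤ d *ℤ (q *ℤ 0ℤ)
    ℤ-identity = solve-∀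
  ... | no A≢0 | yes refl = begin
    ∑[ y < p ] χ (A * (y * y) + 0#)
      ≡⟨ ∑-cong (λ y → cong χ (+-identityʳ (A * (y * y)))) ⟩
    ∑[ y < p ] χ (A * (y * y))
      ≡⟨ ∑χ[Ay²]≡χA[p-1] A≢0 ⟩
    χ A *ℤ (+ p -ℤ 1ℤ)
      ≡⟨ ℤ-identity (χ A) (+ p) (χ 0#) ⟩
    -ℤ χ A +ℤ 0ℤ *ℤ (+ p *ℤ χ 0#) +ℤ 1ℤ *ℤ (+ p *ℤ χ A)
      ∎
    where
    ℤ-identity : ∀ a q c → a *ℤ (q -ℤ 1ℤ) ≡ -ℤ a +ℤ 0ℤ *ℤ (q *ℤ c) +ℤ 1ℤ *ℤ (q *ℤ a)
    ℤ-identity = solve-∀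
  ... | no A≢0 | no B≢0 = begin
    ∑[ y < p ] χ (A * (y * y) + B)
      ≡⟨ ∑χ[Ay²+B]≡-χA A≢0 B≢0 ⟩
    -ℤ χ A
      ≡⟨ ℤ-identity (χ A) (+ p *ℤ χ B) (+ p *ℤ χ A) ⟩
    -ℤ χ A +ℤ 0ℤ *ℤ (+ p *ℤ χ B) +ℤ 0ℤ *ℤ (+ p *ℤ χ A)
      ∎
    where
    ℤ-identity : ∀ a b c → -ℤ a ≡ -ℤ a +ℤ 0ℤ *ℤ b +ℤ 0ℤ *ℤ c
    ℤ-identity = solve-∀

  ∑-δ-square-* : ∀ D {c} (f : Fin p → ℤ) → (∀ x → x * x ≡ D → f x ≡ c) →
    ∑[ x < p ] (δ (x * x) D *ℤ f x) ≡ (1ℤ +ℤ χ D) *ℤ c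
  ∑-δ-square-* D {c} f f≡c = begin
    ∑[ x < p ] (δ (x * x) D *ℤ f x)   ≡⟨ ∑-cong (λ x → 𝟙-*-cong (x * x ≟ D) (f≡c x)) ⟩
    ∑[ x < p ] (δ (x * x) D *ℤ c)     ≡⟨ ∑-*ʳ c (λ x → δ (x * x) D) ⟩
    ∑[ x < p ] δ (x * x) D *ℤ c       ≡⟨ cong (_*ℤ c) (∑-δ-square D) ⟩
    (1ℤ +ℤ χ D) *ℤ c                  ∎

  -- The binder annotation (t : Fin p) is needed for the abstraction to match the body of legendre.
  legendre≡χ∘embed : ∀ n → legendre p n ≡ χ (embed n)
  legendre≡χ∘embed n with n % p ℕ.≟ 0
  ... | yes n%p≡0 = sym (χ-zero (embed-≡ (trans n%p≡0 (sym 0%n≡0))))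
  ... | no  n%p≢0 with any? (λ (t : Fin p) → (toℕ t ℕ.* toℕ t) % p ℕ.≟ n % p)
  ...   | yes (t , tt≡n) = sym (χ-residue embed-n≢0 (t , toℕ-injective (begin
    toℕ (t * t)                ≡⟨ toℕ-* t t ⟩
    (toℕ t ℕ.* toℕ t) % p      ≡⟨ tt≡n ⟩
    n % p                      ≡⟨ toℕ-embed n ⟨
    toℕ (embed n)              ∎)))
    where
    embed-n≢0 : embed n ≢ 0#
    embed-n≢0 n≡0 = n%p≢0 (trans (sym (toℕ-embed n)) (trans (cong toℕ n≡0) toℕ-0#))
  ...   | no ¬□n = sym (χ-nonresidue λ (t , tt≡n) → ¬□n (t , (begin
    (toℕ t ℕ.* toℕ t) % p      ≡⟨ toℕ-* t t ⟨
    toℕ (t * t)                ≡⟨ cong toℕ tt≡n ⟩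
    toℕ (embed n)              ≡⟨ toℕ-embed n ⟩
    n % p                      ∎)))

module SolutionCount (p : ℕ) .{{_ : NonZero p}} (p-prime : Prime p) (2<p : 2 < p) (k : Fin p) where

  open QuadraticCharacter p p-prime 2<p

  A B : Fin p → Fin p
  A x = x * x - 4#
  B x = 4# * (k + 2# - x * x)

  𝟙-solution : Fin p → Fin p → Fin p → ℤ
  𝟙-solution x y z = δ (x * x + y * y + z * z) (k + x * y * z + 2#)

  ∑-solutions-over-z : ∀ x y → ∑[ z < p ] 𝟙-solution x y z ≡ 1ℤ +ℤ χ (A x * (y * y) + B x)
  ∑-solutions-over-z x y = begin
    ∑[ z < p ] 𝟙-solution x y z                           ≡⟨ ∑-cong (λ z → sym (δ-cong-difference 4#≢0 (complete-square z))) ⟩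
    ∑[ z < p ] δ ((2# * z - x * y) * (2# * z - x * y)) D  ≡⟨ ∑-affine (- (x * y)) 2#≢0 (λ w → δ (w * w) D) ⟩
    ∑[ w < p ] δ (w * w) D                                ≡⟨ ∑-δ-square D ⟩
    1ℤ +ℤ χ D                                             ∎
    where
    D = A x * (y * y) + B x
    complete-square : ∀ z → (2# * z - x * y) * (2# * z - x * y) - D
                          ≡ 4# * (x * x + y * y + z * z - (k + x * y * z + 2#))
    complete-square z = solve 4 (λ x y z k →
      (con (+ 2) :* z :- x :* y) :* (con (+ 2) :* z :- x :* y)
        :- ((x :* x :- con (+ 4)) :* (y :* y) :+ con (+ 4) :* (k :+ con (+ 2) :- x :* x))
      := con (+ 4) :* (x :* x :+ y :* y :+ z :* z :- (k :+ x :* y :* z :+ con (+ 2)))) refl x y z k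

  ∑-solutions-over-yz : ∀ x → ∑[ y < p ] ∑[ z < p ] 𝟙-solution x y z
    ≡ + p +ℤ (-ℤ χ (A x) +ℤ δ (A x) 0# *ℤ (+ p *ℤ χ (B x)) +ℤ δ (B x) 0# *ℤ (+ p *ℤ χ (A x)))
  ∑-solutions-over-yz x = begin
    ∑[ y < p ] ∑[ z < p ] 𝟙-solution x y z                 ≡⟨ ∑-cong (∑-solutions-over-z x) ⟩
    ∑[ y < p ] (1ℤ +ℤ χ (A x * (y * y) + B x))             ≡⟨ ∑-distrib-+ (λ _ → 1ℤ) (λ y → χ (A x * (y * y) + B x)) ⟩
    ∑[ y < p ] 1ℤ +ℤ ∑[ y < p ] χ (A x * (y * y) + B x)    ≡⟨ cong₂ _+ℤ_ ∑1≡p (∑χ[Ay²+B] (A x) (B x)) ⟩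
    + p +ℤ (-ℤ χ (A x) +ℤ δ (A x) 0# *ℤ (+ p *ℤ χ (B x)) +ℤ δ (B x) 0# *ℤ (+ p *ℤ χ (A x))) ∎

  ∑-χ[A]-term : ∑[ x < p ] (-ℤ χ (A x)) ≡ 1ℤ
  ∑-χ[A]-term = trans (∑-neg (λ x → χ (A x))) (cong -ℤ_ (∑χ[z²+B]≡-1 (-‿≢0 4#≢0)))

  ∑-[A≡0]-term : ∑[ x < p ] (δ (A x) 0# *ℤ (+ p *ℤ χ (B x))) ≡ (1ℤ +ℤ 1ℤ) *ℤ (+ p *ℤ χ (k - 2#))
  ∑-[A≡0]-term = begin
    ∑[ x < p ] (δ (A x) 0# *ℤ (+ p *ℤ χ (B x)))
      ≡⟨ ∑-cong (λ x → cong (_*ℤ (+ p *ℤ χ (B x))) (δ-cong-difference 1#≢0 (A-diff x))) ⟩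
    ∑[ x < p ] (δ (x * x) 4# *ℤ (+ p *ℤ χ (B x)))
      ≡⟨ ∑-δ-square-* 4# (λ x → + p *ℤ χ (B x)) (λ x xx≡4 → cong (+ p *ℤ_) (χ[B]≡ x xx≡4)) ⟩
    (1ℤ +ℤ χ 4#) *ℤ (+ p *ℤ χ (k - 2#))
      ≡⟨ cong (λ c → (1ℤ +ℤ c) *ℤ (+ p *ℤ χ (k - 2#))) (χ-residue 4#≢0 4#-isSquare) ⟩
    (1ℤ +ℤ 1ℤ) *ℤ (+ p *ℤ χ (k - 2#))
      ∎
    where
    A-diff : ∀ x → A x - 0# ≡ 1# * (x * x - 4#)
    A-diff x = solve 1 (λ x → x :* x :- con (+ 4) :- con (+ 0) := con (+ 1) :* (x :* x :- con (+ 4))) refl x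
    χ[B]≡ : ∀ x → x * x ≡ 4# → χ (B x) ≡ χ (k - 2#)
    χ[B]≡ x xx≡4 = begin
      χ (4# * (k + 2# - x * x))   ≡⟨ cong (λ a → χ (4# * (k + 2# - a))) xx≡4 ⟩
      χ (4# * (k + 2# - 4#))      ≡⟨ cong χ (solve 1 (λ k →
                                       con (+ 4) :* (k :+ con (+ 2) :- con (+ 4)) := con (+ 4) :* (k :- con (+ 2))) refl k) ⟩
      χ (4# * (k - 2#))           ≡⟨ χ-*-residue 4#≢0 4#-isSquare (k - 2#) ⟩
      χ (k - 2#)                  ∎

  ∑-[B≡0]-term : ∑[ x < p ] (δ (B x) 0# *ℤ (+ p *ℤ χ (A x))) ≡ (1ℤ +ℤ χ (k + 2#)) *ℤ (+ p *ℤ χ (k - 2#))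
  ∑-[B≡0]-term = begin
    ∑[ x < p ] (δ (B x) 0# *ℤ (+ p *ℤ χ (A x)))
      ≡⟨ ∑-cong (λ x → cong (_*ℤ (+ p *ℤ χ (A x))) (δ-cong-difference (-‿≢0 4#≢0) (B-diff x))) ⟩
    ∑[ x < p ] (δ (x * x) (k + 2#) *ℤ (+ p *ℤ χ (A x)))
      ≡⟨ ∑-δ-square-* (k + 2#) (λ x → + p *ℤ χ (A x)) (λ x xx≡k+2 → cong (+ p *ℤ_) (χ[A]≡ x xx≡k+2)) ⟩
    (1ℤ +ℤ χ (k + 2#)) *ℤ (+ p *ℤ χ (k - 2#))
      ∎
    where
    B-diff : ∀ x → B x - 0# ≡ - 4# * (x * x - (k + 2#))
    B-diff x = solve 2 (λ x k → con (+ 4) :* (k :+ con (+ 2) :- x :* x) :- con (+ 0)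
                               := :- con (+ 4) :* (x :* x :- (k :+ con (+ 2)))) refl x k
    χ[A]≡ : ∀ x → x * x ≡ k + 2# → χ (A x) ≡ χ (k - 2#)
    χ[A]≡ x xx≡k+2 = cong χ (begin
      x * x - 4#        ≡⟨ cong (_- 4#) xx≡k+2 ⟩
      k + 2# - 4#       ≡⟨ solve 1 (λ k → k :+ con (+ 2) :- con (+ 4) := k :- con (+ 2)) refl k ⟩
      k - 2#            ∎)

  ∑-solutions : ∑[ x < p ] ∑[ y < p ] ∑[ z < p ] 𝟙-solution x y z
    ≡ + p *ℤ + p +ℤ ((+ 3 +ℤ χ (k + 2#)) *ℤ χ (k - 2#)) *ℤ + p +ℤ + 1
  ∑-solutions = begin
    ∑[ x < p ] ∑[ y < p ] ∑[ z < p ] 𝟙-solution x y z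
      ≡⟨ ∑-cong ∑-solutions-over-yz ⟩
    ∑[ x < p ] (+ p +ℤ (-ℤ χ (A x) +ℤ δ (A x) 0# *ℤ (+ p *ℤ χ (B x)) +ℤ δ (B x) 0# *ℤ (+ p *ℤ χ (A x))))
      ≡⟨ ∑-distrib-+ (λ _ → + p) (λ x → t₁ x +ℤ t₂ x +ℤ t₃ x) ⟩
    ∑[ x < p ] (+ p) +ℤ ∑[ x < p ] (-ℤ χ (A x) +ℤ δ (A x) 0# *ℤ (+ p *ℤ χ (B x)) +ℤ δ (B x) 0# *ℤ (+ p *ℤ χ (A x)))
      ≡⟨ cong₂ _+ℤ_ (∑-const p (+ p))
           (trans (∑-distrib-+ (λ x → t₁ x +ℤ t₂ x) t₃) (cong₂ _+ℤ_ (∑-distrib-+ t₁ t₂) refl)) ⟩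
    + p *ℤ + p +ℤ (∑[ x < p ] (-ℤ χ (A x)) +ℤ ∑[ x < p ] (δ (A x) 0# *ℤ (+ p *ℤ χ (B x)))
                   +ℤ ∑[ x < p ] (δ (B x) 0# *ℤ (+ p *ℤ χ (A x))))
      ≡⟨ cong (λ s → + p *ℤ + p +ℤ s) (cong₂ _+ℤ_ (cong₂ _+ℤ_ ∑-χ[A]-term ∑-[A≡0]-term) ∑-[B≡0]-term) ⟩
    + p *ℤ + p +ℤ (1ℤ +ℤ (1ℤ +ℤ 1ℤ) *ℤ (+ p *ℤ χ (k - 2#)) +ℤ (1ℤ +ℤ χ (k + 2#)) *ℤ (+ p *ℤ χ (k - 2#)))
      ≡⟨ ℤ-identity (+ p) (χ (k + 2#)) (χ (k - 2#)) ⟩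
    + p *ℤ + p +ℤ ((+ 3 +ℤ χ (k + 2#)) *ℤ χ (k - 2#)) *ℤ + p +ℤ + 1
      ∎
    where
    t₁ t₂ t₃ : Fin p → ℤ
    t₁ x = -ℤ χ (A x)
    t₂ x = δ (A x) 0# *ℤ (+ p *ℤ χ (B x))
    t₃ x = δ (B x) 0# *ℤ (+ p *ℤ χ (A x))
    ℤ-identity : ∀ q c m → q *ℤ q +ℤ (1ℤ +ℤ (1ℤ +ℤ 1ℤ) *ℤ (q *ℤ m) +ℤ (1ℤ +ℤ c) *ℤ (q *ℤ m))
                          ≡ q *ℤ q +ℤ ((+ 3 +ℤ c) *ℤ m) *ℤ q +ℤ + 1
    ℤ-identity = solve-∀

  solutionCount≡∑ : + solutionCount p k ≡ ∑[ x < p ] ∑[ y < p ] ∑[ z < p ] 𝟙-solution x y z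
  solutionCount≡∑ = trans (+length-filter-triples≡∑∑∑-𝟙 p _) (∑-cong λ x → ∑-cong λ y → ∑-cong λ z →
    trans (𝟙-%-≟≡δ _ _) (cong₂ δ (lhs x y z) (rhs x y z)))
    where
    lhs : ∀ x y z → embed (toℕ x ℕ.* toℕ x ℕ.+ toℕ y ℕ.* toℕ y ℕ.+ toℕ z ℕ.* toℕ z) ≡ x * x + y * y + z * z
    lhs x y z = begin
      embed (toℕ x ℕ.* toℕ x ℕ.+ toℕ y ℕ.* toℕ y ℕ.+ toℕ z ℕ.* toℕ z)
        ≡⟨ embed-+ _ (toℕ z ℕ.* toℕ z) ⟩
      embed (toℕ x ℕ.* toℕ x ℕ.+ toℕ y ℕ.* toℕ y) + embed (toℕ z ℕ.* toℕ z)
        ≡⟨ cong₂ _+_ (embed-+ (toℕ x ℕ.* toℕ x) (toℕ y ℕ.* toℕ y)) (embed-toℕ-* z z) ⟩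
      embed (toℕ x ℕ.* toℕ x) + embed (toℕ y ℕ.* toℕ y) + z * z
        ≡⟨ cong₂ (λ a b → a + b + z * z) (embed-toℕ-* x x) (embed-toℕ-* y y) ⟩
      x * x + y * y + z * z ∎
    rhs : ∀ x y z → embed (toℕ k ℕ.+ toℕ x ℕ.* toℕ y ℕ.* toℕ z ℕ.+ 2) ≡ k + x * y * z + 2#
    rhs x y z = begin
      embed (toℕ k ℕ.+ toℕ x ℕ.* toℕ y ℕ.* toℕ z ℕ.+ 2)
        ≡⟨ embed-+ _ 2 ⟩
      embed (toℕ k ℕ.+ toℕ x ℕ.* toℕ y ℕ.* toℕ z) + 2#
        ≡⟨ cong (_+ 2#) (embed-+ (toℕ k) _) ⟩
      embed (toℕ k) + embed (toℕ x ℕ.* toℕ y ℕ.* toℕ z) + 2#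
        ≡⟨ cong₂ (λ a b → a + b + 2#) (embed-toℕ k) (embed-* (toℕ x ℕ.* toℕ y) (toℕ z)) ⟩
      k + embed (toℕ x ℕ.* toℕ y) * embed (toℕ z) + 2#
        ≡⟨ cong₂ (λ a b → k + a * b + 2#) (embed-toℕ-* x y) (embed-toℕ z) ⟩
      k + x * y * z + 2# ∎

  legendre[k+2]≡χ : legendre p (toℕ k ℕ.+ 2) ≡ χ (k + 2#)
  legendre[k+2]≡χ = trans (legendre≡χ∘embed _)
    (cong χ (trans (embed-+ (toℕ k) 2) (cong (_+ 2#) (embed-toℕ k))))

  legendre[k-2]≡χ : legendre p (toℕ k ℕ.+ (p ℕ.∸ 2)) ≡ χ (k - 2#)
  legendre[k-2]≡χ = trans (legendre≡χ∘embed _)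
    (cong χ (trans (embed-+ (toℕ k) (p ℕ.∸ 2)) (cong₂ _+_ (embed-toℕ k) (sym -2#≡embed[p∸2]))))
    where
    -2#≡embed[p∸2] : - 2# ≡ embed (p ℕ.∸ 2)
    -2#≡embed[p∸2] = trans (-‿embed 2#) (cong (λ m → embed (p ℕ.∸ m)) (trans (toℕ-embed 2) (m<n⇒m%n≡m 2<p)))

-- Imported only here: inside the modules above, ℕ's _+_ would clash with the field's.
open import Data.Nat using (_+_; _∸_)

lemma5p13 : (p : ℕ) → .{{_ : NonZero p}} → Prime p → p > 5 → (k : Fin p) →
    + (solutionCount p k)
      ≡ (+ p *ℤ + p)
        +ℤ ((+ 3 +ℤ legendre p (toℕ k + 2)) *ℤ legendre p (toℕ k + (p ∸ 2))) *ℤ + p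
        +ℤ + 1
lemma5p13 p p-prime p>5 k =
  trans solutionCount≡∑ (trans ∑-solutions (cong₂ formula (sym legendre[k+2]≡χ) (sym legendre[k-2]≡χ)))
  where
  2<p : 2 < p
  2<p = ℕP.<-trans (s≤s (s≤s (s≤s z≤n))) p>5
  open SolutionCount p p-prime 2<p k
    using (solutionCount≡∑; ∑-solutions; legendre[k+2]≡χ; legendre[k-2]≡χ)
  formula : ℤ → ℤ → ℤ
  formula c m = (+ p *ℤ + p) +ℤ ((+ 3 +ℤ c) *ℤ m) *ℤ + p +ℤ + 1
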